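{- Let $d\ge 2$ and $n,k\ge 0$ be integers. Then $N_d(n,k)$ equals the number of lattice paths in $\mathcal{F}_d$ consisting of $n$ steps in total, exactly $k$ of which are $(0,1)$ steps.
   Context: $N_d(n,k) = \frac{1}{n+1} \binom{n+1}{k+1} \binom{ n + (n-k)(d-2)+1}{k}$. $\mathcal{F}_d$ is the set of (possibly empty) labelled lattice paths such that: the path starts at $(0,0)$ and always stays on or above the line $y=x$; every step has the form $(\ell,1)$ for some integer $\ell\ge 0$; and every step $(\ell,1)$ with $\ell\ge 1$ is labelled by a composition of $\ell-1$ into $d-1$ nonnegative parts (an ordered list of $d-1$ nonnegative integers summing to $\ell-1$). Equivalently, a path with steps $(\ell_1,1),\dots,(\ell_n,1)$ lies in $\mathcal{F}_d$ (up to labels) iff $\ell_i\ge 0$ and $\sum_{j\le i}\ell_j\le i$ for all $i$. Two labelled paths are the same iff they have the same steps and the same labels. -}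

module Defs where

open import Data.Nat using (ℕ; zero; suc; _+_; _*_; _∸_; _≤_)
open import Data.Nat.Combinatorics using (_C_)
open import Data.Integer using (+_)
open import Data.Rational using (ℚ; _/_)
open import Data.Unit using (⊤)
open import Data.Product using (Σ; _×_; proj₁)
open import Data.List using (List; []; _∷_; map; length)
open import Data.Vec using (Vec)
import Data.Vec as V
open import Relation.Binary.PropositionalEquality using (_≡_)

-- N_d(n,k) = 1/(n+1) * C(n+1,k+1) * C(n + (n-k)(d-2) + 1, k), as a rational.
-- (When k > n the factor C(n+1,k+1) is 0, so truncated subtraction is harmless.)
Nd : ℕ → ℕ → ℕ → ℚ
Nd d n k = (+ ((suc n C suc k) * ((n + (n ∸ k) * (d ∸ 2) + 1) C k))) / suc n

-- Label of a step (ℓ,1): nothing for ℓ = 0; for ℓ = m+1 a composition of m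
-- into d-1 nonnegative parts (ordered list of d-1 naturals summing to m).
Label : ℕ → ℕ → Set
Label d zero    = ⊤
Label d (suc m) = Σ (Vec ℕ (d ∸ 1)) (λ v → V.sum v ≡ m)

Step : ℕ → Set
Step d = Σ ℕ (Label d)

-- Stays on or above y = x: after i steps (i ≥ 1), ℓ_1 + … + ℓ_i ≤ i.
-- Ok i s ls : i steps already taken with horizontal total s, remaining lengths ls.
Ok : ℕ → ℕ → List ℕ → Set
Ok i s []       = ⊤
Ok i s (ℓ ∷ ls) = (s + ℓ ≤ suc i) × Ok (suc i) (s + ℓ) ls

zeros : List ℕ → ℕ
zeros []            = 0
zeros (zero  ∷ ls)  = suc (zeros ls)
zeros (suc _ ∷ ls)  = zeros ls

InF : (d : ℕ) → List (Step d) → Set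
InF d ps = Ok 0 0 (map proj₁ ps)

Paths : ℕ → ℕ → ℕ → Set
Paths d n k = Σ (List (Step d)) (λ ps → InF d ps × (length ps ≡ n) × (zeros (map proj₁ ps) ≡ k))

-- A path lies in F_d iff each prefix has excess Σ (ℓ − 1), over its steps with ℓ ≥ 1, at most
-- its number of (0,1) steps. On reversed paths this is a condition on suffixes, so they can be
-- counted by prepending steps, by length n, number k of (0,1) steps and total excess j ≤ k: the
-- new step is (0,1), or (ℓ,1) with a label in d − 1 parts, which spreads the excess by a
-- convolution with multiset numbers. Induction on n shows that the count is the ballot-type
-- expression (k − j + 1)/(k + 1) · C(n,k) · multichoose((n − k)(d − 1), j), and summing it
-- over j ≤ k gives N_d(n,k).
module Submission where

open import Defs
open import Data.Nat using (ℕ; zero; suc; _+_; _*_; _∸_; _≤_; _<_; z≤n; s≤s; _≤?_)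
open import Data.Nat.Properties
open import Data.Nat.Combinatorics using (_C_; nCn≡1; nC1≡n; k>n⇒nCk≡0; nCk+nC[k+1]≡[n+1]C[k+1])
open import Data.Nat.Tactic.RingSolver using (solve-∀)
open import Data.Nat.ListAction using (sum)
open import Data.Nat.ListAction.Properties using (sum-↭)
open import Data.Integer using (+_)
import Data.Integer as ℤ
import Data.Integer.Properties as ℤ
open import Data.Rational using (_/_)
open import Data.Rational.Properties using (fromℚᵘ-cong)
open import Data.Rational.Unnormalised using (mkℚᵘ; *≡*)
open import Data.Fin using (Fin; zero)
open import Data.Fin.Properties using (+↔⊎)
open import Data.Empty using (⊥; ⊥-elim)
open import Data.Unit using (⊤; tt)
open import Data.Sum using (_⊎_; inj₁; inj₂)
open import Data.Sum.Function.Propositional using (_⊎-↔_)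
open import Data.Product using (Σ; _×_; _,_; proj₁; proj₂)
open import Data.Product.Function.NonDependent.Propositional using (_×-↔_)
open import Data.List using (List; []; _∷_; _∷ʳ_; map; length; reverse; _++_)
open import Data.List.Properties using (unfold-reverse; reverse-involutive; length-reverse; reverse-map)
open import Data.List.Relation.Binary.Permutation.Propositional.Properties using (↭-reverse)
open import Data.Vec using (Vec; []; _∷_)
import Data.Vec as Vec
open import Function.Bundles using (_↔_; mk↔ₛ′)
open import Function.Properties.Inverse using (↔-refl; ↔-sym; ↔-trans)
open import Relation.Nullary using (Irrelevant; ¬_; yes; no)
open import Relation.Binary using (tri<; tri≈; tri>)
open import Relation.Binary.PropositionalEquality
open ≡-Reasoning

-- Multiset numbers and binomial identities

multichoose : ℕ → ℕ → ℕ
multichoose zero    zero    = 1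
multichoose zero    (suc t) = 0
multichoose (suc a) zero    = 1
multichoose (suc a) (suc t) = multichoose (suc a) t + multichoose a (suc t)

-- size-t multisets from a elements that contain one fixed element
multichoose⁺ : ℕ → ℕ → ℕ
multichoose⁺ a zero    = 0
multichoose⁺ a (suc t) = multichoose a t

multichoose-zeroʳ : ∀ a → multichoose a 0 ≡ 1
multichoose-zeroʳ zero    = refl
multichoose-zeroʳ (suc a) = refl

multichoose-oneʳ : ∀ a → multichoose a 1 ≡ a
multichoose-oneʳ zero    = refl
multichoose-oneʳ (suc a) = cong suc (multichoose-oneʳ a)

multichoose-oneˡ : ∀ t → multichoose 1 t ≡ 1
multichoose-oneˡ zero    = refl
multichoose-oneˡ (suc t) = trans (+-identityʳ (multichoose 1 t)) (multichoose-oneˡ t)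

multichoose-split : ∀ a t → multichoose (suc a) t ≡ multichoose⁺ (suc a) t + multichoose a t
multichoose-split a zero    = sym (multichoose-zeroʳ a)
multichoose-split a (suc t) = refl

multichoose-absorption : ∀ a t → suc t * multichoose a (suc t) ≡ a * multichoose (suc a) t
multichoose-absorption zero    t       = *-zeroʳ (suc t)
multichoose-absorption (suc a) zero    =
  trans (+-identityʳ _) (trans (multichoose-oneʳ (suc a)) (sym (*-identityʳ (suc a))))
multichoose-absorption (suc a) (suc t) = begin
  suc (suc t) * (x + y)            ≡⟨ expand t x y ⟩
  x + suc t * x + suc (suc t) * y  ≡⟨ cong₂ (λ p q → x + p + q) (multichoose-absorption (suc a) t)
                                                                (multichoose-absorption a (suc t)) ⟩
  x + suc a * z + a * x            ≡⟨ collect a x z ⟩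
  suc a * (z + x)                  ∎
  where
  x = multichoose (suc a) (suc t)
  y = multichoose a (suc (suc t))
  z = multichoose (suc (suc a)) t
  expand : ∀ t x y → suc (suc t) * (x + y) ≡ x + suc t * x + suc (suc t) * y
  expand = solve-∀
  collect : ∀ a x z → x + suc a * z + a * x ≡ suc a * (z + x)
  collect = solve-∀

multichoose⁺-absorption : ∀ a t → t * multichoose a t ≡ a * multichoose⁺ (suc a) t
multichoose⁺-absorption a zero    = sym (*-zeroʳ a)
multichoose⁺-absorption a (suc t) = multichoose-absorption a t

multichoose≡C : ∀ a t → multichoose (suc a) t ≡ (t + a) C t
multichoose≡C zero    t       =
  trans (multichoose-oneˡ t) (sym (trans (cong (_C t) (+-identityʳ t)) (nCn≡1 t)))
multichoose≡C (suc a) zero    = refl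
multichoose≡C (suc a) (suc t) = begin
  multichoose (suc (suc a)) t + multichoose (suc a) (suc t)
    ≡⟨ cong₂ _+_ (multichoose≡C (suc a) t) (multichoose≡C a (suc t)) ⟩
  (t + suc a) C t + (suc t + a) C suc t
    ≡⟨ cong (λ m → (t + suc a) C t + m C suc t) (sym (+-suc t a)) ⟩
  (t + suc a) C t + (t + suc a) C suc t
    ≡⟨ nCk+nC[k+1]≡[n+1]C[k+1] (t + suc a) t ⟩
  suc (t + suc a) C suc t ∎

[1+n]*nCk≡[1+k]*[1+n]C[1+k] : ∀ n k → suc n * (n C k) ≡ suc k * (suc n C suc k)
[1+n]*nCk≡[1+k]*[1+n]C[1+k] zero    zero    = refl
[1+n]*nCk≡[1+k]*[1+n]C[1+k] zero    (suc k) = sym (*-zeroʳ (suc (suc k)))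
[1+n]*nCk≡[1+k]*[1+n]C[1+k] (suc n) zero    =
  trans (*-identityʳ (suc (suc n))) (sym (trans (+-identityʳ _) (nC1≡n (suc (suc n)))))
[1+n]*nCk≡[1+k]*[1+n]C[1+k] (suc n) (suc k) = begin
  suc (suc n) * A                                  ≡⟨ peel n A ⟩
  A + suc n * A                                    ≡⟨ cong (λ m → A + suc n * m)
                                                         (sym (nCk+nC[k+1]≡[n+1]C[k+1] n k)) ⟩
  A + suc n * (n C k + n C suc k)                  ≡⟨ cong (λ m → A + m) (*-distribˡ-+ (suc n) (n C k) _) ⟩
  A + (suc n * (n C k) + suc n * (n C suc k))      ≡⟨ cong₂ (λ p q → A + (p + q))
                                                         ([1+n]*nCk≡[1+k]*[1+n]C[1+k] n k)
                                                         ([1+n]*nCk≡[1+k]*[1+n]C[1+k] n (suc k)) ⟩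
  A + (suc k * A + suc (suc k) * B)                ≡⟨ collect k A B ⟩
  suc (suc k) * (A + B)                            ≡⟨ cong (suc (suc k) *_)
                                                         (nCk+nC[k+1]≡[n+1]C[k+1] (suc n) (suc k)) ⟩
  suc (suc k) * (suc (suc n) C suc (suc k))        ∎
  where
  A = suc n C suc k
  B = suc n C suc (suc k)
  peel : ∀ n A → suc (suc n) * A ≡ A + suc n * A
  peel = solve-∀
  collect : ∀ k A B → A + (suc k * A + suc (suc k) * B) ≡ suc (suc k) * (A + B)
  collect = solve-∀

-- (n ∸ k) * (n C k) ≡ suc k * (n C suc k), written with n = suc k + r
[1+r]*nCk≡[1+k]*nC[1+k] : ∀ k r → suc r * ((suc k + r) C k) ≡ suc k * ((suc k + r) C suc k)
[1+r]*nCk≡[1+k]*nC[1+k] k r = +-cancelʳ-≡ (suc k * X) _ _ (begin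
  suc r * X + suc k * X                    ≡⟨ sym (*-distribʳ-+ X (suc r) (suc k)) ⟩
  (suc r + suc k) * X                      ≡⟨ cong (_* X) (size k r) ⟩
  suc n * X                                ≡⟨ [1+n]*nCk≡[1+k]*[1+n]C[1+k] n k ⟩
  suc k * (suc n C suc k)                  ≡⟨ cong (suc k *_) (sym (nCk+nC[k+1]≡[n+1]C[k+1] n k)) ⟩
  suc k * (X + n C suc k)                  ≡⟨ *-distribˡ-+ (suc k) X (n C suc k) ⟩
  suc k * X + suc k * (n C suc k)          ≡⟨ +-comm (suc k * X) _ ⟩
  suc k * (n C suc k) + suc k * X          ∎)
  where
  n = suc k + r
  X = n C k
  size : ∀ k r → suc r + suc k ≡ suc (suc k + r)
  size = solve-∀

[1+r]*[1+n]Ck≡[1+n]*nCk : ∀ k r → suc r * (suc (k + r) C k) ≡ suc (k + r) * ((k + r) C k)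
[1+r]*[1+n]Ck≡[1+n]*nCk k r =
  trans ([1+r]*nCk≡[1+k]*nC[1+k] k r) (sym ([1+n]*nCk≡[1+k]*[1+n]C[1+k] (k + r) k))

-- The counting recursion

guard≤ : ℕ → ℕ → ℕ → ℕ
guard≤ zero    k       x = x
guard≤ (suc j) zero    x = 0
guard≤ (suc j) (suc k) x = guard≤ j k x

guard≤-yes : ∀ {j k} x → j ≤ k → guard≤ j k x ≡ x
guard≤-yes x z≤n       = refl
guard≤-yes x (s≤s j≤k) = guard≤-yes x j≤k

guard≤-no : ∀ {j k} x → k < j → guard≤ j k x ≡ 0
guard≤-no {suc j} {zero}  x _         = refl
guard≤-no {suc j} {suc k} x (s≤s k<j) = guard≤-no x k<j

guard≤-zero : ∀ j k → guard≤ j k 0 ≡ 0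
guard≤-zero zero    k       = refl
guard≤-zero (suc j) zero    = refl
guard≤-zero (suc j) (suc k) = guard≤-zero j k

-- conv a g j = Σ_{i ≤ j} multichoose a i * g (j ∸ i), computed by Pascal's rule in a
conv : ℕ → (ℕ → ℕ) → ℕ → ℕ
conv zero    g j       = g j
conv (suc a) g zero    = conv a g zero
conv (suc a) g (suc j) = conv (suc a) g j + conv a g (suc j)

conv-zero : ∀ a {g} → (∀ i → g i ≡ 0) → ∀ j → conv a g j ≡ 0
conv-zero zero    g≡0 j       = g≡0 j
conv-zero (suc a) g≡0 zero    = conv-zero a g≡0 zero
conv-zero (suc a) g≡0 (suc j) = cong₂ _+_ (conv-zero (suc a) g≡0 j) (conv-zero a g≡0 (suc j))

atPred : (ℕ → ℕ → ℕ) → ℕ → ℕ → ℕ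
atPred f zero    j = 0
atPred f (suc k) j = f k j

-- Reversed paths with n steps, k of them (0,1), and excess j, for labels with c parts:
-- the first step is (0,1) or (1 + |v|, 1) with label v ∈ ℕ^c (see pathCount-↔).
pathCount : ℕ → ℕ → ℕ → ℕ → ℕ
pathCount c zero    zero    zero    = 1
pathCount c zero    zero    (suc j) = 0
pathCount c zero    (suc k) j       = 0
pathCount c (suc n) k       j       =
  guard≤ j k (atPred (pathCount c n) k j + conv c (pathCount c n k) j)

pathCount-excess>zeros : ∀ c n {k j} → k < j → pathCount c n k j ≡ 0
pathCount-excess>zeros c zero    {zero}  {suc j} _   = refl
pathCount-excess>zeros c zero    {suc k}         _   = refl
pathCount-excess>zeros c (suc n)                 k<j = guard≤-no _ k<j

pathCount-zeros>steps : ∀ c {n k} → n < k → ∀ j → pathCount c n k j ≡ 0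
pathCount-zeros>steps c {zero}  {suc k} _         j = refl
pathCount-zeros>steps c {suc n} {suc k} (s≤s n<k) j = begin
  guard≤ j (suc k) (pathCount c n k j + conv c (pathCount c n (suc k)) j)
    ≡⟨ cong₂ (λ x y → guard≤ j (suc k) (x + y)) (pathCount-zeros>steps c n<k j)
         (conv-zero c (pathCount-zeros>steps c (m<n⇒m<1+n n<k)) j) ⟩
  guard≤ j (suc k) 0
    ≡⟨ guard≤-zero j (suc k) ⟩
  0 ∎

pathCount-diagonal : ∀ c n j → pathCount c n n j ≡ multichoose 0 j
pathCount-diagonal c zero    zero    = refl
pathCount-diagonal c zero    (suc j) = refl
pathCount-diagonal c (suc n) j       = begin
  guard≤ j (suc n) (pathCount c n n j + conv c (pathCount c n (suc n)) j)
    ≡⟨ cong₂ (λ x y → guard≤ j (suc n) (x + y)) (pathCount-diagonal c n j)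
         (conv-zero c (pathCount-zeros>steps c (n<1+n n)) j) ⟩
  guard≤ j (suc n) (multichoose 0 j + 0)
    ≡⟨ unguard j ⟩
  multichoose 0 j ∎
  where
  unguard : ∀ j → guard≤ j (suc n) (multichoose 0 j + 0) ≡ multichoose 0 j
  unguard zero    = refl
  unguard (suc j) = guard≤-zero (suc j) (suc n)

-- The ballot formula

-- g j ≡ (k ∸ j + 1) / (k + 1) * B * multichoose R j for j ≤ k
BallotForm : (ℕ → ℕ) → ℕ → ℕ → ℕ → Set
BallotForm g k R B = ∀ j u → j + u ≡ k → suc k * g j ≡ suc u * B * multichoose R j

ballotForm-vanishing : ∀ {g k R} → (∀ j → g j ≡ 0) → BallotForm g k R 0
ballotForm-vanishing {g} {k} {R} g≡0 j u _ =
  trans (cong (suc k *_) (g≡0 j))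
        (trans (*-zeroʳ (suc k)) (sym (cong (_* multichoose R j) (*-zeroʳ (suc u)))))

conv-ballotForm : ∀ {g k R B} → BallotForm g k R B → ∀ a j u → j + u ≡ k →
                  suc k * conv a g j ≡ B * (suc u * multichoose (a + R) j + a * multichoose⁺ (suc (a + R)) j)
conv-ballotForm {g} {k} {R} {B} bf zero j u e = trans (bf j u e) (shape u B (multichoose R j))
  where
  shape : ∀ u B x → suc u * B * x ≡ B * (suc u * x + 0 * 0)
  shape = solve-∀
conv-ballotForm {g} {k} {R} {B} bf (suc a) zero u e = begin
  suc k * conv a g 0                                        ≡⟨ conv-ballotForm {R = R} {B = B} bf a 0 u e ⟩
  B * (suc u * multichoose (a + R) 0 + a * 0)               ≡⟨ cong (λ m → B * (suc u * m + a * 0))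
                                                                 (multichoose-zeroʳ (a + R)) ⟩
  B * (suc u * 1 + a * 0)                                   ≡⟨ shape a u B ⟩
  B * (suc u * 1 + suc a * 0)                               ∎
  where
  shape : ∀ a u B → B * (suc u * 1 + a * 0) ≡ B * (suc u * 1 + suc a * 0)
  shape = solve-∀
conv-ballotForm {g} {k} {R} {B} bf (suc a) (suc j) u e = begin
  suc k * (conv (suc a) g j + conv a g (suc j))
    ≡⟨ *-distribˡ-+ (suc k) (conv (suc a) g j) _ ⟩
  suc k * conv (suc a) g j + suc k * conv a g (suc j)
    ≡⟨ cong₂ _+_ (conv-ballotForm {R = R} {B = B} bf (suc a) j (suc u) (trans (+-suc j u) e))
                 (conv-ballotForm {R = R} {B = B} bf a (suc j) u e) ⟩
  B * (suc (suc u) * X + suc a * Y) + B * (suc u * Z + a * X)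
    ≡⟨ collect B u a X Y Z ⟩
  B * (suc u * (X + Z) + suc a * (Y + X))
    ≡⟨ cong (λ m → B * (suc u * (X + Z) + suc a * m)) (sym (multichoose-split (suc (a + R)) j)) ⟩
  B * (suc u * (X + Z) + suc a * multichoose (suc (suc (a + R))) j) ∎
  where
  X = multichoose (suc (a + R)) j
  Y = multichoose⁺ (suc (suc (a + R))) j
  Z = multichoose (a + R) (suc j)
  collect : ∀ B u a X Y Z → B * (suc (suc u) * X + suc a * Y) + B * (suc u * Z + a * X)
                           ≡ B * (suc u * (X + Z) + suc a * (Y + X))
  collect = solve-∀

ClosedForm : ℕ → ℕ → Set
ClosedForm c n = ∀ k → BallotForm (pathCount c n k) k ((n ∸ k) * c) (n C k)

ballotForm-at : ∀ c {n} k r → k + r ≡ n → ClosedForm c n →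
                BallotForm (pathCount c n k) k (r * c) (n C k)
ballotForm-at c k r refl cf =
  subst (λ m → BallotForm (pathCount c (k + r) k) k (m * c) ((k + r) C k)) (m+n∸m≡n k r) (cf k)

closedForm-vanishing : ∀ c {n k} → n < k → BallotForm (pathCount c n k) k ((n ∸ k) * c) (n C k)
closedForm-vanishing c {n} {k} n<k =
  subst (BallotForm (pathCount c n k) k ((n ∸ k) * c)) (sym (k>n⇒nCk≡0 n<k))
        (ballotForm-vanishing {k = k} {R = (n ∸ k) * c} (pathCount-zeros>steps c n<k))

closedForm-diagonal : ∀ c n → BallotForm (pathCount c n n) n ((n ∸ n) * c) (n C n)
closedForm-diagonal c n j u e = begin
  suc n * pathCount c n n j                      ≡⟨ cong (suc n *_) (pathCount-diagonal c n j) ⟩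
  suc n * multichoose 0 j                        ≡⟨ unit j u e ⟩
  suc u * 1 * multichoose 0 j                    ≡⟨ cong₂ (λ b m → suc u * b * multichoose (m * c) j)
                                                      (sym (nCn≡1 n)) (sym (n∸n≡0 n)) ⟩
  suc u * (n C n) * multichoose ((n ∸ n) * c) j  ∎
  where
  unit : ∀ j u → j + u ≡ n → suc n * multichoose 0 j ≡ suc u * 1 * multichoose 0 j
  unit zero    u e = trans (cong (λ m → suc m * 1) (sym e)) (sym (*-identityʳ (suc u * 1)))
  unit (suc j) u e = trans (*-zeroʳ (suc n)) (sym (*-zeroʳ (suc u * 1)))

closedForm-zero : ∀ c → ClosedForm c 0
closedForm-zero c zero    = closedForm-diagonal c 0
closedForm-zero c (suc k) = closedForm-vanishing c (s≤s z≤n)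

-- Contribution of reversed paths whose first step is (0,1).
atPred-ballot : ∀ c k r → ClosedForm c (k + r) → ∀ j u → j + u ≡ k →
                suc r * (suc k * atPred (pathCount c (k + r)) k j)
                ≡ suc k * u * ((k + r) C k) * multichoose (suc r * c) j
atPred-ballot c zero    r cf j zero    e = *-zeroʳ (suc r)
atPred-ballot c zero    r cf j (suc u) e = ⊥-elim (m+1+n≢0 j e)
atPred-ballot c (suc k) r cf j zero    e = begin
  suc r * (suc (suc k) * pathCount c (suc k + r) k j)
    ≡⟨ cong (λ x → suc r * (suc (suc k) * x)) (pathCount-excess>zeros c (suc k + r) k<j) ⟩
  suc r * (suc (suc k) * 0)
    ≡⟨ vanish r k ((suc k + r) C suc k) (multichoose (suc r * c) j) ⟩
  suc (suc k) * 0 * ((suc k + r) C suc k) * multichoose (suc r * c) j ∎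
  where
  k<j : k < j
  k<j = subst (k <_) (sym (trans (sym (+-identityʳ j)) e)) (n<1+n k)
  vanish : ∀ r k B W → suc r * (suc (suc k) * 0) ≡ suc (suc k) * 0 * B * W
  vanish = solve-∀
atPred-ballot c (suc k) r cf j (suc u) e = *-cancelˡ-≡ _ _ (suc k) (begin
  suc k * (suc r * (suc (suc k) * P))     ≡⟨ regroup₁ k r P ⟩
  suc r * suc (suc k) * (suc k * P)       ≡⟨ cong (suc r * suc (suc k) *_) previous ⟩
  suc r * suc (suc k) * (suc u * B′ * W)  ≡⟨ regroup₂ r k u B′ W ⟩
  suc (suc k) * suc u * W * (suc r * B′)  ≡⟨ cong (suc (suc k) * suc u * W *_)
                                                  ([1+r]*nCk≡[1+k]*nC[1+k] k r) ⟩
  suc (suc k) * suc u * W * (suc k * B)   ≡⟨ regroup₃ k u W B ⟩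
  suc k * (suc (suc k) * suc u * B * W)   ∎)
  where
  n  = suc k + r
  P  = pathCount c n k j
  B′ = n C k
  B  = n C suc k
  W  = multichoose (suc r * c) j
  previous : suc k * P ≡ suc u * B′ * W
  previous = ballotForm-at c k (suc r) (+-suc k r) cf j u (suc-injective (trans (sym (+-suc j u)) e))
  regroup₁ : ∀ k r P → suc k * (suc r * (suc (suc k) * P)) ≡ suc r * suc (suc k) * (suc k * P)
  regroup₁ = solve-∀
  regroup₂ : ∀ r k u B W → suc r * suc (suc k) * (suc u * B * W) ≡ suc (suc k) * suc u * W * (suc r * B)
  regroup₂ = solve-∀
  regroup₃ : ∀ k u W B → suc (suc k) * suc u * W * (suc k * B) ≡ suc k * (suc (suc k) * suc u * B * W)
  regroup₃ = solve-∀

-- Contribution of reversed paths whose first step carries a label.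
conv-ballot : ∀ c k r → ClosedForm c (k + r) → ∀ j u → j + u ≡ k →
              suc r * (suc k * conv c (pathCount c (k + r) k) j)
              ≡ ((k + r) C k) * multichoose (suc r * c) j * (suc r * suc u + j)
conv-ballot c k r cf j u e = begin
  suc r * (suc k * conv c (pathCount c (k + r) k) j)
    ≡⟨ cong (suc r *_) (conv-ballotForm {R = r * c} {B = B} (ballotForm-at c k r refl cf) c j u e) ⟩
  suc r * (B * (suc u * W + c * W⁺))
    ≡⟨ spread r B u W c W⁺ ⟩
  B * (suc r * suc u * W + (c + r * c) * W⁺)
    ≡⟨ cong (λ m → B * (suc r * suc u * W + m)) (sym (multichoose⁺-absorption (c + r * c) j)) ⟩
  B * (suc r * suc u * W + j * W)
    ≡⟨ collect B r u W j ⟩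
  B * W * (suc r * suc u + j) ∎
  where
  B  = (k + r) C k
  W  = multichoose (c + r * c) j
  W⁺ = multichoose⁺ (suc (c + r * c)) j
  spread : ∀ r B u W c W⁺ → suc r * (B * (suc u * W + c * W⁺))
                            ≡ B * (suc r * suc u * W + (c + r * c) * W⁺)
  spread = solve-∀
  collect : ∀ B r u W j → B * (suc r * suc u * W + j * W) ≡ B * W * (suc r * suc u + j)
  collect = solve-∀

closedForm-step : ∀ c k r → ClosedForm c (k + r) →
                  BallotForm (pathCount c (suc (k + r)) k) k ((suc (k + r) ∸ k) * c) (suc (k + r) C k)
closedForm-step c k r cf j u e = *-cancelˡ-≡ _ _ (suc r) (begin
  suc r * (suc k * pathCount c (suc n) k j)
    ≡⟨ cong (λ x → suc r * (suc k * x)) (guard≤-yes (P₀ + Q) j≤k) ⟩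
  suc r * (suc k * (P₀ + Q))
    ≡⟨ distrib r k P₀ Q ⟩
  suc r * (suc k * P₀) + suc r * (suc k * Q)
    ≡⟨ cong₂ _+_ (atPred-ballot c k r cf j u e) (conv-ballot c k r cf j u e) ⟩
  suc k * u * B * W + B * W * (suc r * suc u + j)
    ≡⟨ collect k u B W r j ⟩
  B * W * (suc k * u + suc r * suc u + j)
    ≡⟨ cong (B * W *_) weights ⟩
  B * W * (suc u * suc n)
    ≡⟨ regroup B W u n ⟩
  suc u * W * (suc n * B)
    ≡⟨ cong (suc u * W *_) (sym ([1+r]*[1+n]Ck≡[1+n]*nCk k r)) ⟩
  suc u * W * (suc r * (suc n C k))
    ≡⟨ regroup′ u W r (suc n C k) ⟩
  suc r * (suc u * (suc n C k) * W)
    ≡⟨ cong (λ m → suc r * (suc u * (suc n C k) * multichoose (m * c) j)) (sym 1+n∸k≡1+r) ⟩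
  suc r * (suc u * (suc n C k) * multichoose ((suc n ∸ k) * c) j) ∎)
  where
  n  = k + r
  P₀ = atPred (pathCount c n) k j
  Q  = conv c (pathCount c n k) j
  B  = n C k
  W  = multichoose (suc r * c) j
  j≤k : j ≤ k
  j≤k = subst (j ≤_) e (m≤m+n j u)
  1+n∸k≡1+r : suc n ∸ k ≡ suc r
  1+n∸k≡1+r = trans (cong (_∸ k) (sym (+-suc k r))) (m+n∸m≡n k (suc r))
  distrib : ∀ r k P Q → suc r * (suc k * (P + Q)) ≡ suc r * (suc k * P) + suc r * (suc k * Q)
  distrib = solve-∀
  collect : ∀ k u B W r j → suc k * u * B * W + B * W * (suc r * suc u + j)
                           ≡ B * W * (suc k * u + suc r * suc u + j)
  collect = solve-∀
  weights-ring : ∀ j u r → suc (j + u) * u + suc r * suc u + j ≡ suc u * suc (j + u + r)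
  weights-ring = solve-∀
  weights : suc k * u + suc r * suc u + j ≡ suc u * suc n
  weights = subst (λ k → suc k * u + suc r * suc u + j ≡ suc u * suc (k + r)) e (weights-ring j u r)
  regroup : ∀ B W u n → B * W * (suc u * suc n) ≡ suc u * W * (suc n * B)
  regroup = solve-∀
  regroup′ : ∀ u W r C → suc u * W * (suc r * C) ≡ suc r * (suc u * C * W)
  regroup′ = solve-∀

closedForm-suc : ∀ c n → ClosedForm c n → ClosedForm c (suc n)
closedForm-suc c n cf k with <-cmp k (suc n)
... | tri< (s≤s k≤n) _ _ with m≤n⇒∃[o]m+o≡n k≤n
...   | r , refl = closedForm-step c k r cf
closedForm-suc c n cf k | tri≈ _ refl _ = closedForm-diagonal c (suc n)
closedForm-suc c n cf k | tri> _ _ n<k  = closedForm-vanishing c n<k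

closedForm : ∀ c n → ClosedForm c n
closedForm c zero    = closedForm-zero c
closedForm c (suc n) = closedForm-suc c n (closedForm c n)

-- The sum of pathCount c n k j over j ≤ k, since multichoose 1 ≡ 1
total : ℕ → ℕ → ℕ → ℕ
total c n k = conv 1 (pathCount c n k) k

total-count-below : ∀ e k r → let n = k + r in
                    suc n * total (suc e) n k ≡ (suc n C suc k) * ((n + (n ∸ k) * e + 1) C k)
total-count-below e k r = *-cancelˡ-≡ _ _ (suc k) (begin
  suc k * (suc n * total c n k)
    ≡⟨ swap k n (total c n k) ⟩
  suc n * (suc k * total c n k)
    ≡⟨ cong (suc n *_) (conv-ballotForm {R = R} {B = B} (ballotForm-at c k r refl (closedForm c n))
                                        1 k 0 (+-identityʳ k)) ⟩
  suc n * (B * (1 * multichoose (suc R) k + 1 * multichoose⁺ (suc (suc R)) k))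
    ≡⟨ cong (λ m → suc n * (B * m)) combine ⟩
  suc n * (B * multichoose (suc (suc R)) k)
    ≡⟨ sym (*-assoc (suc n) B _) ⟩
  suc n * B * multichoose (suc (suc R)) k
    ≡⟨ cong₂ _*_ ([1+n]*nCk≡[1+k]*[1+n]C[1+k] n k) (multichoose≡C (suc R) k) ⟩
  suc k * (suc n C suc k) * ((k + suc R) C k)
    ≡⟨ *-assoc (suc k) (suc n C suc k) _ ⟩
  suc k * ((suc n C suc k) * ((k + suc R) C k))
    ≡⟨ cong (λ m → suc k * ((suc n C suc k) * (m C k))) top ⟩
  suc k * ((suc n C suc k) * ((n + (n ∸ k) * e + 1) C k)) ∎)
  where
  c = suc e
  n = k + r
  R = r * c
  B = n C k
  swap : ∀ k n S → suc k * (suc n * S) ≡ suc n * (suc k * S)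
  swap = solve-∀
  combine : 1 * multichoose (suc R) k + 1 * multichoose⁺ (suc (suc R)) k ≡ multichoose (suc (suc R)) k
  combine = trans (cong₂ _+_ (*-identityˡ (multichoose (suc R) k))
                             (*-identityˡ (multichoose⁺ (suc (suc R)) k)))
                  (trans (+-comm (multichoose (suc R) k) _) (sym (multichoose-split (suc R) k)))
  top : k + suc R ≡ n + (n ∸ k) * e + 1
  top = trans (expand k r e) (cong (λ m → k + r + m * e + 1) (sym (m+n∸m≡n k r)))
    where
    expand : ∀ k r e → k + suc (r * suc e) ≡ k + r + r * e + 1
    expand = solve-∀

total-count : ∀ e n k → suc n * total (suc e) n k ≡ (suc n C suc k) * ((n + (n ∸ k) * e + 1) C k)
total-count e n k with k ≤? n
... | yes k≤n with m≤n⇒∃[o]m+o≡n k≤n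
...   | r , refl = total-count-below e k r
total-count e n k | no k≰n = begin
  suc n * total (suc e) n k
    ≡⟨ cong (suc n *_) (conv-zero 1 (pathCount-zeros>steps (suc e) n<k) k) ⟩
  suc n * 0
    ≡⟨ *-zeroʳ (suc n) ⟩
  0
    ≡⟨ cong (_* ((n + (n ∸ k) * e + 1) C k)) (sym (k>n⇒nCk≡0 (s≤s n<k))) ⟩
  (suc n C suc k) * ((n + (n ∸ k) * e + 1) C k) ∎
  where
  n<k = ≰⇒> k≰n

[1+n]*m/[1+n]≡m/1 : ∀ n m → (+ (suc n * m)) / suc n ≡ (+ m) / 1
[1+n]*m/[1+n]≡m/1 n m = fromℚᵘ-cong {mkℚᵘ (+ (suc n * m)) n} {mkℚᵘ (+ m) 0} (*≡* (begin
  + (suc n * m) ℤ.* + 1   ≡⟨ ℤ.*-identityʳ _ ⟩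
  + (suc n * m)           ≡⟨ cong +_ (*-comm (suc n) m) ⟩
  + (m * suc n)           ≡⟨ ℤ.pos-* m (suc n) ⟩
  + m ℤ.* + suc n         ∎))

-- Reversed paths

lengths : ∀ {d} → List (Step d) → List ℕ
lengths = map proj₁

excess : List ℕ → ℕ
excess []           = 0
excess (zero  ∷ ls) = excess ls
excess (suc t ∷ ls) = t + excess ls

Balanced : List ℕ → Set
Balanced []       = ⊤
Balanced (ℓ ∷ ls) = excess (ℓ ∷ ls) ≤ zeros (ℓ ∷ ls) × Balanced ls

sum+zeros≡length+excess : ∀ ls → sum ls + zeros ls ≡ length ls + excess ls
sum+zeros≡length+excess []           = refl
sum+zeros≡length+excess (zero  ∷ ls) =
  trans (+-suc (sum ls) (zeros ls)) (cong suc (sum+zeros≡length+excess ls))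
sum+zeros≡length+excess (suc t ∷ ls) = cong suc (begin
  t + sum ls + zeros ls          ≡⟨ +-assoc t (sum ls) (zeros ls) ⟩
  t + (sum ls + zeros ls)        ≡⟨ cong (λ m → t + m) (sum+zeros≡length+excess ls) ⟩
  t + (length ls + excess ls)    ≡⟨ x+[y+z]≡y+[x+z] t (length ls) (excess ls) ⟩
  length ls + (t + excess ls)    ∎)
  where
  x+[y+z]≡y+[x+z] : ∀ x y z → x + (y + z) ≡ y + (x + z)
  x+[y+z]≡y+[x+z] = solve-∀

≤-exchange : ∀ {a b c d} → a + d ≡ b + c → a ≤ b → c ≤ d
≤-exchange {a} {b} {c} {d} eq a≤b = +-cancelˡ-≤ b c d (subst (_≤ b + d) eq (+-monoˡ-≤ d a≤b))

sum≤length⇒excess≤zeros : ∀ ls → sum ls ≤ length ls → excess ls ≤ zeros ls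
sum≤length⇒excess≤zeros ls = ≤-exchange (sum+zeros≡length+excess ls)

excess≤zeros⇒sum≤length : ∀ ls → excess ls ≤ zeros ls → sum ls ≤ length ls
excess≤zeros⇒sum≤length ls = ≤-exchange (trans (+-comm (excess ls) _)
                                                (trans (sym (sum+zeros≡length+excess ls)) (+-comm (sum ls) _)))

zeros-++ : ∀ xs ys → zeros (xs ++ ys) ≡ zeros xs + zeros ys
zeros-++ []           ys = refl
zeros-++ (zero  ∷ xs) ys = cong suc (zeros-++ xs ys)
zeros-++ (suc _ ∷ xs) ys = zeros-++ xs ys

zeros-reverse : ∀ ls → zeros (reverse ls) ≡ zeros ls
zeros-reverse []       = refl
zeros-reverse (ℓ ∷ ls) = begin
  zeros (reverse (ℓ ∷ ls))             ≡⟨ cong zeros (unfold-reverse ℓ ls) ⟩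
  zeros (reverse ls ∷ʳ ℓ)              ≡⟨ zeros-++ (reverse ls) (ℓ ∷ []) ⟩
  zeros (reverse ls) + zeros (ℓ ∷ [])  ≡⟨ cong (_+ zeros (ℓ ∷ [])) (zeros-reverse ls) ⟩
  zeros ls + zeros (ℓ ∷ [])            ≡⟨ +-comm (zeros ls) _ ⟩
  zeros (ℓ ∷ []) + zeros ls            ≡⟨ sym (zeros-++ (ℓ ∷ []) ls) ⟩
  zeros (ℓ ∷ ls)                       ∎

Ok-∷ʳ⁻ : ∀ i s xs x → Ok i s (xs ∷ʳ x) → Ok i s xs × s + sum xs + x ≤ suc (i + length xs)
Ok-∷ʳ⁻ i s []       x (ok , tt) =
  tt , subst₂ (λ a b → a + x ≤ suc b) (sym (+-identityʳ s)) (sym (+-identityʳ i)) ok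
Ok-∷ʳ⁻ i s (y ∷ ys) x (ok , oks) with Ok-∷ʳ⁻ (suc i) (s + y) ys x oks
... | oks′ , last = (ok , oks′) , subst₂ _≤_ (cong (_+ x) (+-assoc s y (sum ys)))
                                             (cong suc (sym (+-suc i (length ys)))) last

Ok-∷ʳ⁺ : ∀ i s xs x → Ok i s xs → s + sum xs + x ≤ suc (i + length xs) → Ok i s (xs ∷ʳ x)
Ok-∷ʳ⁺ i s []       x tt        last =
  subst₂ (λ a b → a + x ≤ suc b) (+-identityʳ s) (+-identityʳ i) last , tt
Ok-∷ʳ⁺ i s (y ∷ ys) x (ok , oks) last =
  ok , Ok-∷ʳ⁺ (suc i) (s + y) ys x oks (subst₂ _≤_ (cong (_+ x) (sym (+-assoc s y (sum ys))))
                                                   (cong suc (+-suc i (length ys))) last)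

sum-∷-reverse : ∀ ℓ ls → sum (reverse ls) + ℓ ≡ sum (ℓ ∷ ls)
sum-∷-reverse ℓ ls = trans (cong (_+ ℓ) (sum-↭ (↭-reverse ls))) (+-comm (sum ls) ℓ)

Ok-reverse⁻ : ∀ ls → Ok 0 0 (reverse ls) → Balanced ls
Ok-reverse⁻ []       tt = tt
Ok-reverse⁻ (ℓ ∷ ls) ok with Ok-∷ʳ⁻ 0 0 (reverse ls) ℓ (subst (Ok 0 0) (unfold-reverse ℓ ls) ok)
... | ok′ , last = sum≤length⇒excess≤zeros (ℓ ∷ ls) sum≤length , Ok-reverse⁻ ls ok′
  where
  sum≤length : sum (ℓ ∷ ls) ≤ length (ℓ ∷ ls)
  sum≤length = subst₂ _≤_ (sum-∷-reverse ℓ ls) (cong suc (length-reverse ls)) last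

Ok-reverse⁺ : ∀ ls → Balanced ls → Ok 0 0 (reverse ls)
Ok-reverse⁺ []       tt          = tt
Ok-reverse⁺ (ℓ ∷ ls) (last , bal) =
  subst (Ok 0 0) (sym (unfold-reverse ℓ ls)) (Ok-∷ʳ⁺ 0 0 (reverse ls) ℓ (Ok-reverse⁺ ls bal) last′)
  where
  last′ : sum (reverse ls) + ℓ ≤ suc (length (reverse ls))
  last′ = subst₂ _≤_ (sym (sum-∷-reverse ℓ ls)) (cong suc (sym (length-reverse ls)))
                     (excess≤zeros⇒sum≤length (ℓ ∷ ls) last)

×-irrelevant : ∀ {A B : Set} → Irrelevant A → Irrelevant B → Irrelevant (A × B)
×-irrelevant irrA irrB (a , b) (a′ , b′) = cong₂ _,_ (irrA a a′) (irrB b b′)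

Σ-≡-irrelevant : ∀ {A : Set} {P : A → Set} → (∀ a → Irrelevant (P a)) →
                 {x y : Σ A P} → proj₁ x ≡ proj₁ y → x ≡ y
Σ-≡-irrelevant irr {a , p} {.a , q} refl = cong (a ,_) (irr a p q)

Balanced-irrelevant : ∀ ls → Irrelevant (Balanced ls)
Balanced-irrelevant []       = λ _ _ → refl
Balanced-irrelevant (ℓ ∷ ls) = ×-irrelevant ≤-irrelevant (Balanced-irrelevant ls)

Ok-irrelevant : ∀ i s ls → Irrelevant (Ok i s ls)
Ok-irrelevant i s []       = λ _ _ → refl
Ok-irrelevant i s (ℓ ∷ ls) = ×-irrelevant ≤-irrelevant (Ok-irrelevant (suc i) (s + ℓ) ls)

RevPaths : ℕ → ℕ → ℕ → Set
RevPaths d n k = Σ (List (Step d)) λ qs →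
  Balanced (lengths qs) × length qs ≡ n × zeros (lengths qs) ≡ k

RevPathsOfExcess : ℕ → ℕ → ℕ → ℕ → Set
RevPathsOfExcess d n k j = Σ (List (Step d)) λ qs →
  Balanced (lengths qs) × length qs ≡ n × zeros (lengths qs) ≡ k × excess (lengths qs) ≡ j

RevPaths-≡ : ∀ {d n k} {x y : RevPaths d n k} → proj₁ x ≡ proj₁ y → x ≡ y
RevPaths-≡ = Σ-≡-irrelevant λ qs →
  ×-irrelevant (Balanced-irrelevant _) (×-irrelevant ≡-irrelevant ≡-irrelevant)

RevPathsOfExcess-≡ : ∀ {d n k j} {x y : RevPathsOfExcess d n k j} → proj₁ x ≡ proj₁ y → x ≡ y
RevPathsOfExcess-≡ = Σ-≡-irrelevant λ qs →
  ×-irrelevant (Balanced-irrelevant _)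
               (×-irrelevant ≡-irrelevant (×-irrelevant ≡-irrelevant ≡-irrelevant))

Paths-≡ : ∀ {d n k} {x y : Paths d n k} → proj₁ x ≡ proj₁ y → x ≡ y
Paths-≡ = Σ-≡-irrelevant λ qs →
  ×-irrelevant (Ok-irrelevant 0 0 _) (×-irrelevant ≡-irrelevant ≡-irrelevant)

reverse-↔ : ∀ d n k → RevPaths d n k ↔ Paths d n k
reverse-↔ d n k = mk↔ₛ′ to from (λ y → Paths-≡ (reverse-involutive (proj₁ y)))
                                (λ x → RevPaths-≡ (reverse-involutive (proj₁ x)))
  where
  zeros-reverse′ : ∀ (qs : List (Step d)) → zeros (lengths (reverse qs)) ≡ zeros (lengths qs)
  zeros-reverse′ qs = trans (cong zeros (reverse-map proj₁ qs)) (zeros-reverse (lengths qs))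
  to : RevPaths d n k → Paths d n k
  to (qs , bal , len , zs) =
    reverse qs , subst (Ok 0 0) (sym (reverse-map proj₁ qs)) (Ok-reverse⁺ (lengths qs) bal) ,
    trans (length-reverse qs) len , trans (zeros-reverse′ qs) zs
  from : Paths d n k → RevPaths d n k
  from (ps , ok , len , zs) =
    reverse ps ,
    subst Balanced (sym (reverse-map proj₁ ps))
          (Ok-reverse⁻ (reverse (lengths ps)) (subst (Ok 0 0) (sym (reverse-involutive (lengths ps))) ok)) ,
    trans (length-reverse ps) len , trans (zeros-reverse′ ps) zs

-- Bijections with the counts

Conv : ℕ → (ℕ → Set) → ℕ → Set
Conv a G j = Σ (Vec ℕ a) λ v → Vec.sum v ≤ j × G (j ∸ Vec.sum v)

Conv-≡ : ∀ {d n k a j} {v v′ : Vec ℕ a} {p : Vec.sum v ≤ j} {p′ : Vec.sum v′ ≤ j}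
         {x : RevPathsOfExcess d n k (j ∸ Vec.sum v)} {x′ : RevPathsOfExcess d n k (j ∸ Vec.sum v′)} →
         v ≡ v′ → proj₁ x ≡ proj₁ x′ →
         _≡_ {A = Conv a (RevPathsOfExcess d n k) j} (v , p , x) (v′ , p′ , x′)
Conv-≡ {v = v} refl q = cong₂ (λ p x → v , p , x) (≤-irrelevant _ _) (RevPathsOfExcess-≡ q)

AtPred : (ℕ → ℕ → Set) → ℕ → ℕ → Set
AtPred F zero    j = ⊥
AtPred F (suc k) j = F k j

Fin0↔ : ∀ {A : Set} → ¬ A → Fin 0 ↔ A
Fin0↔ ¬a = mk↔ₛ′ (λ ()) (λ a → ⊥-elim (¬a a)) (λ a → ⊥-elim (¬a a)) (λ ())

guard≤-↔ : ∀ j k x → Fin (guard≤ j k x) ↔ (j ≤ k × Fin x)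
guard≤-↔ zero    k       x = mk↔ₛ′ (z≤n ,_) proj₂ (λ { (z≤n , y) → refl }) (λ _ → refl)
guard≤-↔ (suc j) zero    x = Fin0↔ λ { (() , _) }
guard≤-↔ (suc j) (suc k) x = ↔-trans (guard≤-↔ j k x)
  (mk↔ₛ′ (λ { (j≤k , y) → s≤s j≤k , y }) (λ { (s≤s j≤k , y) → j≤k , y })
         (λ { (s≤s _ , _) → refl }) (λ { (_ , _) → refl }))

atPred-↔ : ∀ {f F} → (∀ k j → Fin (f k j) ↔ F k j) → ∀ k j → Fin (atPred f k j) ↔ AtPred F k j
atPred-↔ f↔F zero    j = Fin0↔ λ ()
atPred-↔ f↔F (suc k) j = f↔F k j

Conv-zero-↔ : ∀ {G} j → G j ↔ Conv 0 G j
Conv-zero-↔ j = mk↔ₛ′ (λ x → [] , z≤n , x) (λ { ([] , _ , x) → x })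
                      (λ { ([] , z≤n , x) → refl }) (λ _ → refl)

Conv-suc-zero-↔ : ∀ {a G} → Conv a G 0 ↔ Conv (suc a) G 0
Conv-suc-zero-↔ = mk↔ₛ′ (λ { (v , s≤0 , x) → 0 ∷ v , s≤0 , x }) from to∘from
                        (λ { (_ , _ , _) → refl })
  where
  from : _ → _
  from (zero ∷ v , s≤0 , x) = v , s≤0 , x
  from (suc _ ∷ _ , () , _)
  to∘from : _
  to∘from (zero ∷ v , s≤0 , x) = refl
  to∘from (suc _ ∷ _ , () , _)

Conv-suc-suc-↔ : ∀ {a G} j → (Conv (suc a) G j ⊎ Conv a G (suc j)) ↔ Conv (suc a) G (suc j)
Conv-suc-suc-↔ j = mk↔ₛ′ to from
  (λ { (zero ∷ v , s≤j , x) → refl ; (suc h ∷ v , s≤s s≤j , x) → refl })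
  (λ { (inj₁ (h ∷ v , s≤j , x)) → refl ; (inj₂ (v , s≤j , x)) → refl })
  where
  to : _ → _
  to (inj₁ (h ∷ v , s≤j , x)) = suc h ∷ v , s≤s s≤j , x
  to (inj₂ (v , s≤j , x))     = 0 ∷ v , s≤j , x
  from : _ → _
  from (zero  ∷ v , s≤j , x)     = inj₂ (v , s≤j , x)
  from (suc h ∷ v , s≤s s≤j , x) = inj₁ (h ∷ v , s≤j , x)

conv-↔ : ∀ a {g G} → (∀ j → Fin (g j) ↔ G j) → ∀ j → Fin (conv a g j) ↔ Conv a G j
conv-↔ zero    {G = G} g↔G j       = ↔-trans (g↔G j) (Conv-zero-↔ {G = G} j)
conv-↔ (suc a) {G = G} g↔G zero    = ↔-trans (conv-↔ a g↔G zero) (Conv-suc-zero-↔ {G = G})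
conv-↔ (suc a) {G = G} g↔G (suc j) =
  ↔-trans +↔⊎ (↔-trans (conv-↔ (suc a) g↔G j ⊎-↔ conv-↔ a g↔G (suc j))
                       (Conv-suc-suc-↔ {G = G} j))

firstStep-↔ : ∀ d n k j → RevPathsOfExcess d (suc n) k j
              ↔ (j ≤ k × (AtPred (RevPathsOfExcess d n) k j ⊎ Conv (d ∸ 1) (RevPathsOfExcess d n k) j))
firstStep-↔ d n k j = mk↔ₛ′ (to k) (from k) (to∘from k) (from∘to k)
  where
  Split : ℕ → Set
  Split k = j ≤ k × (AtPred (RevPathsOfExcess d n) k j ⊎ Conv (d ∸ 1) (RevPathsOfExcess d n k) j)

  to : ∀ k → RevPathsOfExcess d (suc n) k j → Split k
  to k       ([] , _ , () , _)
  to zero    ((zero , _) ∷ _ , _ , _ , () , _)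
  to (suc k) ((zero , _) ∷ qs , (ok , bal) , len , zs , ex) =
    subst₂ _≤_ ex zs ok , inj₁ (qs , bal , suc-injective len , suc-injective zs , ex)
  to k       ((suc t , v , refl) ∷ qs , (ok , bal) , len , zs , ex) =
    subst₂ _≤_ ex zs ok ,
    inj₂ (v , subst (Vec.sum v ≤_) ex (m≤m+n (Vec.sum v) _) , (qs , bal , suc-injective len , zs , ex′))
    where
    ex′ : excess (lengths qs) ≡ j ∸ Vec.sum v
    ex′ = sym (trans (cong (_∸ Vec.sum v) (sym ex)) (m+n∸m≡n (Vec.sum v) _))

  from : ∀ k → Split k → RevPathsOfExcess d (suc n) k j
  from (suc k) (ok , inj₁ (qs , bal , len , zs , ex)) =
    (0 , tt) ∷ qs , (subst₂ _≤_ (sym ex) (cong suc (sym zs)) ok , bal) , cong suc len , cong suc zs , ex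
  from k       (ok , inj₂ (v , s≤j , (qs , bal , len , zs , ex))) =
    (suc (Vec.sum v) , v , refl) ∷ qs , (subst₂ _≤_ (sym ex″) (sym zs) ok , bal) , cong suc len , zs , ex″
    where
    ex″ : Vec.sum v + excess (lengths qs) ≡ j
    ex″ = trans (cong (λ m → Vec.sum v + m) ex) (m+[n∸m]≡n s≤j)

  to∘from : ∀ k y → to k (from k y) ≡ y
  to∘from (suc k) (ok , inj₁ x) = cong₂ _,_ (≤-irrelevant _ _) (cong inj₁ (RevPathsOfExcess-≡ refl))
  to∘from zero    (ok , inj₂ _) = cong₂ _,_ (≤-irrelevant _ _) (cong inj₂ (Conv-≡ refl refl))
  to∘from (suc k) (ok , inj₂ _) = cong₂ _,_ (≤-irrelevant _ _) (cong inj₂ (Conv-≡ refl refl))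

  from∘to : ∀ k x → from k (to k x) ≡ x
  from∘to k       ([] , _ , () , _)
  from∘to zero    ((zero , _) ∷ _ , _ , _ , () , _)
  from∘to (suc k) ((zero , _) ∷ _ , _)         = RevPathsOfExcess-≡ refl
  from∘to zero    ((suc _ , _ , refl) ∷ _ , _) = RevPathsOfExcess-≡ refl
  from∘to (suc k) ((suc _ , _ , refl) ∷ _ , _) = RevPathsOfExcess-≡ refl

pathCount-↔ : ∀ d n k j → Fin (pathCount (d ∸ 1) n k j) ↔ RevPathsOfExcess d n k j
pathCount-↔ d zero zero zero = mk↔ₛ′ (λ _ → [] , tt , refl , refl , refl) (λ _ → zero)
  (λ y → RevPathsOfExcess-≡ (sym (empty y))) (λ { zero → refl })
  where
  empty : (y : RevPathsOfExcess d 0 0 0) → proj₁ y ≡ []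
  empty ([] , _)             = refl
  empty (_ ∷ _ , _ , () , _)
pathCount-↔ d zero zero (suc j) = Fin0↔ λ { ([] , _ , _ , _ , ()) ; (_ ∷ _ , _ , () , _) }
pathCount-↔ d zero (suc k) j    = Fin0↔ λ { ([] , _ , _ , () , _) ; (_ ∷ _ , _ , () , _) }
pathCount-↔ d (suc n) k j =
  ↔-trans (guard≤-↔ j k _)
  (↔-trans (↔-refl ×-↔ ↔-trans +↔⊎ (atPred-↔ (pathCount-↔ d n) k j
                                     ⊎-↔ conv-↔ (d ∸ 1) (pathCount-↔ d n k) j))
           (↔-sym (firstStep-↔ d n k j)))

excess-↔ : ∀ d n k → Conv 1 (RevPathsOfExcess d n k) k ↔ RevPaths d n k
excess-↔ d n k = mk↔ₛ′ to from (λ _ → refl) from∘to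
  where
  to : Conv 1 (RevPathsOfExcess d n k) k → RevPaths d n k
  to (_ , _ , (qs , bal , len , zs , _)) = qs , bal , len , zs

  excess≤k : (x : RevPaths d n k) → excess (lengths (proj₁ x)) ≤ k
  excess≤k ([] , _)                   = z≤n
  excess≤k (_ ∷ _ , (ok , _) , _ , zs) = subst (_ ≤_) zs ok

  from : RevPaths d n k → Conv 1 (RevPathsOfExcess d n k) k
  from x@(qs , bal , len , zs) =
    (k ∸ e ∷ []) , subst (_≤ k) (sym (+-identityʳ _)) (m∸n≤m k e) ,
    (qs , bal , len , zs , sym (trans (cong (k ∸_) (+-identityʳ (k ∸ e))) (m∸[m∸n]≡n (excess≤k x))))
    where
    e = excess (lengths qs)

  from∘to : ∀ y → from (to y) ≡ y
  from∘to ((i ∷ []) , i≤k , (qs , bal , len , zs , ex)) = Conv-≡ (cong (_∷ []) k∸e≡i) refl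
    where
    k∸e≡i : k ∸ excess (lengths qs) ≡ i
    k∸e≡i = begin
      k ∸ excess (lengths qs) ≡⟨ cong (k ∸_) ex ⟩
      k ∸ (k ∸ (i + 0))       ≡⟨ m∸[m∸n]≡n i≤k ⟩
      i + 0                   ≡⟨ +-identityʳ i ⟩
      i                       ∎

total-↔ : ∀ d n k → Fin (total (d ∸ 1) n k) ↔ Paths d n k
total-↔ d n k = ↔-trans (conv-↔ 1 (pathCount-↔ d n k) k) (↔-trans (excess-↔ d n k) (reverse-↔ d n k))

theorem4p2 : (d n k : ℕ) → 2 ≤ d →
    Σ ℕ (λ c → (Fin c ↔ Paths d n k) × (Nd d n k ≡ (+ c) / 1))
theorem4p2 1 n k (s≤s ())
theorem4p2 (suc (suc e)) n k _ = total (suc e) n k , total-↔ (2 + e) n k , (begin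
  Nd (2 + e) n k                            ≡⟨ cong (λ m → (+ m) / suc n) (sym (total-count e n k)) ⟩
  (+ (suc n * total (suc e) n k)) / suc n   ≡⟨ [1+n]*m/[1+n]≡m/1 n (total (suc e) n k) ⟩
  (+ total (suc e) n k) / 1                 ∎)
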